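{- Let $\Gamma,\Delta$ be finite subsets of $For_2$ with $\Gamma\cup\Delta$ nonempty. If $\vDash_{\mathbf{B}_3}\Gamma\Rightarrow\Delta$, then $\Gamma\Rightarrow\Delta$ is provable in $\mathbf{B}$ without using the Cut rule. In particular, if $\Gamma\vDash_{\mathbf{B}_3}\alpha$ (with $\Gamma\cup\{\alpha\}$ finite) then $\Gamma\Rightarrow\alpha$ is provable in $\mathbf{B}$.
   Context: Fix a denumerable set $prop$ of propositional variables. $For_2$ is the set of formulas built from $prop$ with a unary connective $\lnot$ and a binary connective $\wedge$. $var(\alpha)$ is the set of propositional variables in $\alpha$; $var(\Gamma)=\bigcup_{\gamma\in\Gamma}var(\gamma)$. A sequent $\Gamma\Rightarrow\Delta$ is an ordered pair of finite sets of formulas, not both empty; $\alpha,\Gamma$ denotes $\Gamma\cup\{\alpha\}$. The calculus $\mathbf{B}$ has the axiom $\alpha\Rightarrow\alpha$ and the rules (premises / conclusion): (W$\Rightarrow$) $\Gamma\Rightarrow\Delta$ / $\alpha,\Gamma\Rightarrow\Delta$; ($\Rightarrow$W) $\Gamma\Rightarrow\Delta$ / $\Gamma\Rightarrow\Delta,\alpha$; (Cut) $\Gamma\Rightarrow\Delta,\alpha$ and $\alpha,\Gamma\Rightarrow\Delta$ / $\Gamma\Rightarrow\Delta$; ($\lnot\Rightarrow$) $\Gamma\Rightarrow\Delta,\alpha$ / $\lnot\alpha,\Gamma\Rightarrow\Delta$; ($\Rightarrow\lnot^B$) $\alpha,\Gamma\Rightarrow\Delta$ / $\Gamma\Rightarrow\Delta,\lnot\alpha$,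 allowed only if $var(\alpha)\subseteq var(\Gamma)$; ($\wedge\Rightarrow$) $\alpha_1,\alpha_2,\Gamma\Rightarrow\Delta$ / $\alpha_1\wedge\alpha_2,\Gamma\Rightarrow\Delta$; ($\Rightarrow\wedge$) $\Gamma\Rightarrow\Delta,\alpha_1$ and $\Gamma\Rightarrow\Delta,\alpha_2$ / $\Gamma\Rightarrow\Delta,\alpha_1\wedge\alpha_2$. Bochvar's logic $\mathbf{B}_3$ on $For_2$: truth values $\{1,\tfrac12,0\}$ with designated set $\{1\}$; valuations extend maps $prop\to\{1,\tfrac12,0\}$ by $\lnot1=0,\lnot\tfrac12=\tfrac12,\lnot0=1$, and $x\wedge y=\tfrac12$ if $x=\tfrac12$ or $y=\tfrac12$, otherwise classical conjunction. $\vDash_{\mathbf{B}_3}\Gamma\Rightarrow\Delta$ means: for every valuation $v$, if $v(\gamma)=1$ for all $\gamma\in\Gamma$ then $v(\delta)=1$ for some $\delta\in\Delta$. $\Gamma\vDash_{\mathbf{B}_3}\alpha$ means every valuation giving value $1$ to all of $\Gamma$ gives $1$ to $\alpha$. -}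

module Defs where

open import Data.Nat using (ℕ)
open import Data.Bool using (Bool; true; false)
open import Data.List using (List; []; _∷_; _++_; [_]; concatMap)
open import Data.List.Membership.Propositional using (_∈_)
open import Data.List.Relation.Unary.Any using (Any)
open import Data.List.Relation.Unary.All using (All)
open import Data.Empty using (⊥)
open import Data.Unit using (⊤)
open import Data.Product using (_×_)
open import Relation.Binary.PropositionalEquality using (_≡_)

Prop : Set
Prop = ℕ

data Formula : Set where
  var : Prop → Formula
  ¬'_ : Formula → Formula
  _∧'_ : Formula → Formula → Formula

vars : Formula → List Prop
vars (var p) = p ∷ []
vars (¬' a) = vars a
vars (a ∧' b) = vars a ++ vars b

varsL : List Formula → List Prop
varsL = concatMap vars

_⊆v_ : List Prop → List Prop → Set
xs ⊆v ys = ∀ {p} → p ∈ xs → p ∈ ys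

-- finite sets of formulas are represented by lists; two lists denote the
-- same finite set iff they have the same members
_≈set_ : List Formula → List Formula → Set
Γ ≈set Γ' = (∀ {a} → a ∈ Γ → a ∈ Γ') × (∀ {a} → a ∈ Γ' → a ∈ Γ)

-- The Bool index says whether Cut may be used.
-- "α , Γ" (= Γ ∪ {α}) is rendered as α ∷ Γ, and "Δ , α" as α ∷ Δ;
-- the rule 'set' makes derivability a property of the underlying sets.
data _⊢_⇒_ (c : Bool) : List Formula → List Formula → Set where
  ax   : ∀ {a} → c ⊢ [ a ] ⇒ [ a ]
  set  : ∀ {Γ Γ' Δ Δ'} → Γ ≈set Γ' → Δ ≈set Δ' →
         c ⊢ Γ ⇒ Δ → c ⊢ Γ' ⇒ Δ'
  wl   : ∀ {Γ Δ a} → c ⊢ Γ ⇒ Δ → c ⊢ (a ∷ Γ) ⇒ Δ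
  wr   : ∀ {Γ Δ a} → c ⊢ Γ ⇒ Δ → c ⊢ Γ ⇒ (a ∷ Δ)
  cut  : ∀ {Γ Δ a} → c ≡ true →
         c ⊢ Γ ⇒ (a ∷ Δ) → c ⊢ (a ∷ Γ) ⇒ Δ → c ⊢ Γ ⇒ Δ
  ¬l   : ∀ {Γ Δ a} → c ⊢ Γ ⇒ (a ∷ Δ) → c ⊢ ((¬' a) ∷ Γ) ⇒ Δ
  ¬rB  : ∀ {Γ Δ a} → vars a ⊆v varsL Γ →
         c ⊢ (a ∷ Γ) ⇒ Δ → c ⊢ Γ ⇒ ((¬' a) ∷ Δ)
  ∧l   : ∀ {Γ Δ a b} → c ⊢ (a ∷ b ∷ Γ) ⇒ Δ → c ⊢ ((a ∧' b) ∷ Γ) ⇒ Δ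
  ∧r   : ∀ {Γ Δ a b} → c ⊢ Γ ⇒ (a ∷ Δ) → c ⊢ Γ ⇒ (b ∷ Δ) →
         c ⊢ Γ ⇒ ((a ∧' b) ∷ Δ)

B⊢_⇒_ : List Formula → List Formula → Set
B⊢ Γ ⇒ Δ = true ⊢ Γ ⇒ Δ

B⊢cf_⇒_ : List Formula → List Formula → Set
B⊢cf Γ ⇒ Δ = false ⊢ Γ ⇒ Δ

data V3 : Set where
  one half zero : V3

neg3 : V3 → V3
neg3 one = zero
neg3 half = half
neg3 zero = one

and3 : V3 → V3 → V3
and3 half _ = half
and3 one half = half
and3 zero half = half
and3 one one = one
and3 one zero = zero
and3 zero one = zero
and3 zero zero = zero

eval : (Prop → V3) → Formula → V3
eval v (var p) = v p
eval v (¬' a) = neg3 (eval v a)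
eval v (a ∧' b) = and3 (eval v a) (eval v b)

⊨B3_⇒_ : List Formula → List Formula → Set
⊨B3 Γ ⇒ Δ = ∀ (v : Prop → V3) →
  All (λ g → eval v g ≡ one) Γ → Any (λ d → eval v d ≡ one) Δ

_⊨B3_ : List Formula → Formula → Set
Γ ⊨B3 a = ∀ (v : Prop → V3) →
  All (λ g → eval v g ≡ one) Γ → eval v a ≡ one

NonEmpty : List Formula → Set
NonEmpty [] = ⊥
NonEmpty (_ ∷ _) = ⊤

module Submission where

-- Let Γ ⇒ Δ be B₃-valid and let Δ' ⊆ Δ consist of the formulas of Δ
-- whose variables all occur in Γ.  For a classical valuation s, the B₃
-- valuation that agrees with s on var(Γ) and is 1/2 elsewhere satisfies Γ
-- exactly when s does, and since 1/2 is infectious it can only designate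
-- formulas of Δ'.  Hence Γ ⇒ Δ' is classically valid and var(Δ') ⊆ var(Γ).
--
-- For such sequents the usual invertible-rule proof search of classical
-- logic succeeds in B without Cut: the side condition of (⇒¬ᴮ) is kept
-- true throughout the search by the invariant "every variable of a pending
-- succedent formula occurs in the antecedent".  Weakening Δ' back to Δ
-- gives the first claim; the second follows because cut-free derivations
-- are derivations.

open import Defs
open import Data.Bool using (Bool; true; false; not; _∧_; T)
open import Data.Bool.Properties using (T-∧)
open import Data.Empty using (⊥; ⊥-elim)
open import Data.List using (List; []; _∷_; _++_; map; filter)
open import Data.List.Membership.Propositional using (_∈_; _∉_; find; lose)
open import Data.List.Membership.Propositional.Properties
  using (∈-++⁻; ∈-++⁺ˡ; ∈-++⁺ʳ; ∈-map⁺; ∈-filter⁺; ∈-filter⁻)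
open import Data.List.Relation.Binary.Subset.Propositional using (_⊆_)
open import Data.List.Relation.Binary.Subset.Propositional.Properties
  using (⊆-refl; ⊆-trans; xs⊆x∷xs; xs⊆xs++ys; xs⊆ys++xs; ∷⁺ʳ; ∈-∷⁺ʳ; concatMap⁺; filter-⊆)
open import Data.List.Relation.Unary.All as All using (All; []; _∷_)
open import Data.List.Relation.Unary.Any using (Any; here; there)
import Data.List.Membership.DecPropositional as DecMembership
import Data.List.Relation.Binary.Subset.DecPropositional as DecSubset
open import Data.Nat using (ℕ; suc; _+_; _≤_; _<_; s≤s; _≟_)
open import Data.Nat.Induction using (<-wellFounded)
open import Data.Nat.Properties using (≤-reflexive; +-assoc; +-comm; +-identityʳ; +-monoˡ-≤; m≤m+n; m≤n+m; n<1+n)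
open import Data.Product using (_×_; _,_; proj₁; proj₂; ∃-syntax)
open import Data.Sum using (_⊎_; inj₁; inj₂; [_,_]; map₁)
open import Function using (_∘_)
open import Function.Bundles using (Equivalence)
open import Induction.WellFounded using (Acc; acc)
open import Relation.Binary.PropositionalEquality using (_≡_; refl; sym; trans; cong; cong₂)
open import Relation.Nullary using (Dec; yes; no)
open import Relation.Nullary.Decidable using (isYes; fromWitness; toWitness)

open DecMembership _≟_ using (_∈?_)
open DecSubset _≟_ using (_⊆?_)

embed : ∀ {c Γ Δ} → B⊢cf Γ ⇒ Δ → c ⊢ Γ ⇒ Δ
embed ax = ax
embed (set Γ≈ Δ≈ d) = set Γ≈ Δ≈ (embed d)
embed (wl d) = wl (embed d)
embed (wr d) = wr (embed d)
embed (cut () d e)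
embed (¬l d) = ¬l (embed d)
embed (¬rB vs d) = ¬rB vs (embed d)
embed (∧l d) = ∧l (embed d)
embed (∧r d e) = ∧r (embed d) (embed e)

++-⊆ : ∀ {A : Set} {xs ys zs : List A} → xs ⊆ zs → ys ⊆ zs → xs ++ ys ⊆ zs
++-⊆ {xs = xs} xs⊆zs ys⊆zs m = [ xs⊆zs , ys⊆zs ] (∈-++⁻ xs m)

weakenL++ : ∀ {c Γ Δ} Θ → c ⊢ Γ ⇒ Δ → c ⊢ (Θ ++ Γ) ⇒ Δ
weakenL++ [] d = d
weakenL++ (_ ∷ Θ) d = wl (weakenL++ Θ d)

weakenR++ : ∀ {c Γ Δ} Θ → c ⊢ Γ ⇒ Δ → c ⊢ Γ ⇒ (Θ ++ Δ)
weakenR++ [] d = d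
weakenR++ (_ ∷ Θ) d = wr (weakenR++ Θ d)

-- Weakening to arbitrary supersets: Θ ++ Γ and Θ denote the same set when
-- Γ ⊆ Θ, so the 'set' rule finishes iterated weakening.
weaken : ∀ {c Γ Δ Γ' Δ'} → c ⊢ Γ ⇒ Δ → Γ ⊆ Γ' → Δ ⊆ Δ' → c ⊢ Γ' ⇒ Δ'
weaken {Γ' = Γ'} {Δ'} d Γ⊆Γ' Δ⊆Δ' =
  set (++-⊆ ⊆-refl Γ⊆Γ' , xs⊆xs++ys Γ' _) (++-⊆ ⊆-refl Δ⊆Δ' , xs⊆xs++ys Δ' _)
      (weakenR++ Δ' (weakenL++ Γ' d))

contractL : ∀ {c Γ Δ a} → a ∈ Γ → c ⊢ (a ∷ Γ) ⇒ Δ → c ⊢ Γ ⇒ Δ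
contractL a∈Γ d = weaken d (∈-∷⁺ʳ a∈Γ ⊆-refl) ⊆-refl

contractR : ∀ {c Γ Δ a} → a ∈ Δ → c ⊢ Γ ⇒ (a ∷ Δ) → c ⊢ Γ ⇒ Δ
contractR a∈Δ d = weaken d ⊆-refl (∈-∷⁺ʳ a∈Δ ⊆-refl)

varsL-⊆ : ∀ {Δ Θ} → (∀ {d} → d ∈ Δ → vars d ⊆ Θ) → varsL Δ ⊆ Θ
varsL-⊆ {[]} h ()
varsL-⊆ {d ∷ Δ} h = ++-⊆ (h (here refl)) (varsL-⊆ (h ∘ there))

vars-∈ : ∀ {Γ a} → a ∈ Γ → vars a ⊆ varsL Γ
vars-∈ {a ∷ Γ} (here refl) = xs⊆xs++ys (vars a) (varsL Γ)
vars-∈ {b ∷ Γ} (there a∈Γ) = ⊆-trans (vars-∈ a∈Γ) (xs⊆ys++xs (varsL Γ) (vars b))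

varsL-mono : ∀ {Γ Γ'} → Γ ⊆ Γ' → varsL Γ ⊆ varsL Γ'
varsL-mono = concatMap⁺ vars

ceval : (Prop → Bool) → Formula → Bool
ceval s (var p) = s p
ceval s (¬' a) = not (ceval s a)
ceval s (a ∧' b) = ceval s a ∧ ceval s b

_⊨_ : (Prop → Bool) → Formula → Set
s ⊨ a = T (ceval s a)

⊨₂_⇒_ : List Formula → List Formula → Set
⊨₂ Γ ⇒ Δ = ∀ s → All (s ⊨_) Γ → Any (s ⊨_) Δ

bivalent : ∀ x → T x ⊎ T (not x)
bivalent true = inj₁ _
bivalent false = inj₂ _

consistent : ∀ x → T x → T (not x) → ⊥
consistent true _ ()

-- A search state splits the goal sequent Γ ⇒ Δ into formulas still to be
-- decomposed (L on the left, R on the right) and atoms already reached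
-- (A on the left, B on the right).

atoms : List Prop → List Formula
atoms = map var

Valid : List Formula → List Prop → List Formula → List Prop → Set
Valid L A R B = ∀ s → All (s ⊨_) L → All (λ p → s ⊨ var p) A →
                Any (s ⊨_) R ⊎ Any (λ p → s ⊨ var p) B

valid-atomL : ∀ {p L A R B} → Valid (var p ∷ L) A R B → Valid L (p ∷ A) R B
valid-atomL h s sL (sp ∷ sA) = h s (sp ∷ sL) sA

valid-¬l : ∀ {a L A R B} → Valid (¬' a ∷ L) A R B → Valid L A (a ∷ R) B
valid-¬l {a} h s sL sA with bivalent (ceval s a)
... | inj₁ sa = inj₁ (here sa)
... | inj₂ s¬a = map₁ there (h s (s¬a ∷ sL) sA)

valid-∧l : ∀ {a b L A R B} → Valid (a ∧' b ∷ L) A R B → Valid (a ∷ b ∷ L) A R B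
valid-∧l h s (sa ∷ sb ∷ sL) sA = h s (Equivalence.from T-∧ (sa , sb) ∷ sL) sA

valid-atomR : ∀ {p L A R B} → Valid L A (var p ∷ R) B → Valid L A R (p ∷ B)
valid-atomR h s sL sA with h s sL sA
... | inj₁ (here sp) = inj₂ (here sp)
... | inj₁ (there sR) = inj₁ sR
... | inj₂ sB = inj₂ (there sB)

valid-¬r : ∀ {a L A R B} → Valid L A (¬' a ∷ R) B → Valid (a ∷ L) A R B
valid-¬r {a} h s (sa ∷ sL) sA with h s sL sA
... | inj₁ (here s¬a) = ⊥-elim (consistent (ceval s a) sa s¬a)
... | inj₁ (there sR) = inj₁ sR
... | inj₂ sB = inj₂ sB

-- Both conjuncts are consequences of a conjunction.
valid-∧r : ∀ {a b x L A R B} → (∀ s → s ⊨ (a ∧' b) → s ⊨ x) →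
           Valid L A (a ∧' b ∷ R) B → Valid L A (x ∷ R) B
valid-∧r ab⇒x h s sL sA with h s sL sA
... | inj₁ (here sab) = inj₁ (here (ab⇒x s sab))
... | inj₁ (there sR) = inj₁ (there sR)
... | inj₂ sB = inj₂ sB

-- A valid atomic state has a common atom: otherwise the valuation making
-- exactly the atoms of A true is a countermodel.
valid-atomic : ∀ {A B} → Valid [] A [] B → ∃[ p ] p ∈ A × p ∈ B
valid-atomic {A} h
  with h (λ p → isYes (p ∈? A)) [] (All.tabulate (λ {p} → fromWitness {a? = p ∈? A}))
... | inj₂ sB with find sB
... | p , p∈B , p∈A = p , toWitness {a? = p ∈? A} p∈A , p∈B

-- The search terminates because every step decreases the total size of the
-- pending formulas.

size : Formula → ℕ
size (var p) = 1
size (¬' a) = suc (size a)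
size (a ∧' b) = suc (size a + size b)

sizeL : List Formula → ℕ
sizeL [] = 0
sizeL (a ∷ L) = size a + sizeL L

weight : List Formula → List Formula → ℕ
weight L R = sizeL L + sizeL R

weight-atomL : ∀ p L R → weight L R < weight (var p ∷ L) R
weight-atomL p L R = n<1+n (weight L R)

weight-¬l : ∀ a L R → weight L (a ∷ R) < weight (¬' a ∷ L) R
weight-¬l a L R = s≤s (≤-reflexive (trans (sym (+-assoc (sizeL L) (size a) (sizeL R)))
                                           (cong (_+ sizeL R) (+-comm (sizeL L) (size a)))))

weight-∧l : ∀ a b L R → weight (a ∷ b ∷ L) R < weight (a ∧' b ∷ L) R
weight-∧l a b L R = s≤s (≤-reflexive
  (cong (_+ sizeL R) (sym (+-assoc (size a) (size b) (sizeL L)))))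

weight-atomR : ∀ p R → weight [] R < weight [] (var p ∷ R)
weight-atomR p R = n<1+n (sizeL R)

weight-¬r : ∀ a R → weight (a ∷ []) R < weight [] (¬' a ∷ R)
weight-¬r a R = s≤s (≤-reflexive (cong (_+ sizeL R) (+-identityʳ (size a))))

weight-∧r : ∀ {x} a b R → size x ≤ size a + size b → weight [] (x ∷ R) < weight [] (a ∧' b ∷ R)
weight-∧r a b R x≤ab = s≤s (+-monoˡ-≤ (sizeL R) x≤ab)

-- Given a valid state whose lists are contained in the
-- goal sequent, and whose pending succedent formulas only use variables of
-- the antecedent (the side condition of (⇒¬ᴮ)), derive the goal without
-- Cut.  Each clause applies one rule backwards; the principal formula stays
-- in the goal, so the rule's conclusion is contracted back to the goal.
search : ∀ {Γ Δ} L A R B → Acc _<_ (weight L R) →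
         L ⊆ Γ → atoms A ⊆ Γ → R ⊆ Δ → atoms B ⊆ Δ → varsL R ⊆ varsL Γ →
         Valid L A R B → B⊢cf Γ ⇒ Δ
search (var p ∷ L) A R B (acc rec) L⊆Γ A⊆Γ R⊆Δ B⊆Δ vR valid =
  search L (p ∷ A) R B (rec (weight-atomL p L R))
    (L⊆Γ ∘ there) (∈-∷⁺ʳ (L⊆Γ (here refl)) A⊆Γ) R⊆Δ B⊆Δ vR (valid-atomL valid)
search (¬' a ∷ L) A R B (acc rec) L⊆Γ A⊆Γ R⊆Δ B⊆Δ vR valid =
  contractL ¬a∈Γ (¬l (search L A (a ∷ R) B (rec (weight-¬l a L R))
    (L⊆Γ ∘ there) A⊆Γ (∷⁺ʳ a R⊆Δ) (there ∘ B⊆Δ) (++-⊆ (vars-∈ ¬a∈Γ) vR) (valid-¬l valid)))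
  where ¬a∈Γ = L⊆Γ (here refl)
search {Γ} (a ∧' b ∷ L) A R B (acc rec) L⊆Γ A⊆Γ R⊆Δ B⊆Δ vR valid =
  contractL (L⊆Γ (here refl)) (∧l (search (a ∷ b ∷ L) A R B (rec (weight-∧l a b L R))
    (∷⁺ʳ a (∷⁺ʳ b (L⊆Γ ∘ there))) (there ∘ there ∘ A⊆Γ) R⊆Δ B⊆Δ
    (⊆-trans vR (varsL-mono {Γ} {a ∷ b ∷ Γ} (there ∘ there))) (valid-∧l valid)))
search [] A (var p ∷ R) B (acc rec) L⊆Γ A⊆Γ R⊆Δ B⊆Δ vR valid =
  search [] A R (p ∷ B) (rec (weight-atomR p R))
    L⊆Γ A⊆Γ (R⊆Δ ∘ there) (∈-∷⁺ʳ (R⊆Δ (here refl)) B⊆Δ)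
    (⊆-trans (xs⊆ys++xs (varsL R) (p ∷ [])) vR) (valid-atomR valid)
search {Γ} [] A (¬' a ∷ R) B (acc rec) L⊆Γ A⊆Γ R⊆Δ B⊆Δ vR valid =
  contractR (R⊆Δ (here refl)) (¬rB (vR ∘ xs⊆xs++ys (vars a) (varsL R))
    (search (a ∷ []) A R B (rec (weight-¬r a R))
      (∷⁺ʳ a λ ()) (there ∘ A⊆Γ) (R⊆Δ ∘ there) B⊆Δ
      (⊆-trans (⊆-trans (xs⊆ys++xs (varsL R) (vars a)) vR) (varsL-mono (xs⊆x∷xs Γ a)))
      (valid-¬r valid)))
search {Γ} {Δ} [] A (a ∧' b ∷ R) B (acc rec) L⊆Γ A⊆Γ R⊆Δ B⊆Δ vR valid =
  contractR (R⊆Δ (here refl))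
    (∧r (conjunct a (m≤m+n (size a) (size b)) (xs⊆xs++ys (vars a) (vars b))
                   (λ s sab → proj₁ (Equivalence.to T-∧ sab)))
        (conjunct b (m≤n+m (size b) (size a)) (xs⊆ys++xs (vars b) (vars a))
                   (λ s sab → proj₂ (Equivalence.to T-∧ sab))))
  where
  conjunct : ∀ x → size x ≤ size a + size b → vars x ⊆ vars (a ∧' b) →
             (∀ s → s ⊨ (a ∧' b) → s ⊨ x) → B⊢cf Γ ⇒ (x ∷ Δ)
  conjunct x x≤ab x⊆ab ab⇒x =
    search [] A (x ∷ R) B (rec (weight-∧r a b R x≤ab))
      L⊆Γ A⊆Γ (∷⁺ʳ x (R⊆Δ ∘ there)) (there ∘ B⊆Δ)
      (++-⊆ (vR ∘ xs⊆xs++ys (vars (a ∧' b)) (varsL R) ∘ x⊆ab) (vR ∘ xs⊆ys++xs (varsL R) (vars (a ∧' b))))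
      (valid-∧r ab⇒x valid)
search [] A [] B _ _ A⊆Γ _ B⊆Δ _ valid with valid-atomic valid
... | p , p∈A , p∈B =
  weaken ax (∈-∷⁺ʳ (A⊆Γ (∈-map⁺ var p∈A)) (λ ())) (∈-∷⁺ʳ (B⊆Δ (∈-map⁺ var p∈B)) (λ ()))

classical-complete : ∀ {Γ Δ} → ⊨₂ Γ ⇒ Δ → varsL Δ ⊆ varsL Γ → B⊢cf Γ ⇒ Δ
classical-complete {Γ} {Δ} valid vΔ =
  search Γ [] Δ [] (<-wellFounded (weight Γ Δ)) ⊆-refl (λ ()) ⊆-refl (λ ()) vΔ
    (λ s sΓ _ → inj₁ (valid s sΓ))

toV3 : Bool → V3
toV3 true = one
toV3 false = zero

toV3-not : ∀ x → neg3 (toV3 x) ≡ toV3 (not x)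
toV3-not true = refl
toV3-not false = refl

toV3-∧ : ∀ x y → and3 (toV3 x) (toV3 y) ≡ toV3 (x ∧ y)
toV3-∧ true true = refl
toV3-∧ true false = refl
toV3-∧ false true = refl
toV3-∧ false false = refl

T⇒one : ∀ {x} → T x → toV3 x ≡ one
T⇒one {true} _ = refl

one⇒T : ∀ {x} → toV3 x ≡ one → T x
one⇒T {true} _ = _

eval-classical : ∀ v s a → (∀ {p} → p ∈ vars a → v p ≡ toV3 (s p)) →
                 eval v a ≡ toV3 (ceval s a)
eval-classical v s (var p) agree = agree (here refl)
eval-classical v s (¬' a) agree =
  trans (cong neg3 (eval-classical v s a agree)) (toV3-not (ceval s a))
eval-classical v s (a ∧' b) agree =
  trans (cong₂ and3 (eval-classical v s a (agree ∘ ∈-++⁺ˡ))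
                    (eval-classical v s b (agree ∘ ∈-++⁺ʳ (vars a))))
        (toV3-∧ (ceval s a) (ceval s b))

and3-half : ∀ x → and3 x half ≡ half
and3-half one = refl
and3-half half = refl
and3-half zero = refl

eval-half : ∀ v a {p} → p ∈ vars a → v p ≡ half → eval v a ≡ half
eval-half v (var p) (here refl) vp≡half = vp≡half
eval-half v (¬' a) p∈a vp≡half = cong neg3 (eval-half v a p∈a vp≡half)
eval-half v (a ∧' b) p∈ab vp≡half with ∈-++⁻ (vars a) p∈ab
... | inj₁ p∈a = cong (λ x → and3 x (eval v b)) (eval-half v a p∈a vp≡half)
... | inj₂ p∈b = trans (cong (and3 (eval v a)) (eval-half v b p∈b vp≡half)) (and3-half (eval v a))

restrict : List Prop → (Prop → Bool) → Prop → V3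
restrict Θ s p with p ∈? Θ
... | yes _ = toV3 (s p)
... | no _ = half

restrict-∈ : ∀ {Θ s p} → p ∈ Θ → restrict Θ s p ≡ toV3 (s p)
restrict-∈ {Θ} {p = p} p∈Θ with p ∈? Θ
... | yes _ = refl
... | no p∉Θ = ⊥-elim (p∉Θ p∈Θ)

restrict-∉ : ∀ {Θ s p} → p ∉ Θ → restrict Θ s p ≡ half
restrict-∉ {Θ} {p = p} p∉Θ with p ∈? Θ
... | yes p∈Θ = ⊥-elim (p∉Θ p∈Θ)
... | no _ = refl

restrict-classical : ∀ {Θ} s a → vars a ⊆ Θ → eval (restrict Θ s) a ≡ toV3 (ceval s a)
restrict-classical s a a⊆Θ = eval-classical _ s a (restrict-∈ ∘ a⊆Θ)

designated-vars : ∀ {Θ} s a → eval (restrict Θ s) a ≡ one → vars a ⊆ Θ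
designated-vars {Θ} s a a≡one {p} p∈a with p ∈? Θ
... | yes p∈Θ = p∈Θ
... | no p∉Θ with trans (sym a≡one) (eval-half _ a p∈a (restrict-∉ p∉Θ))
...   | ()

over? : ∀ Γ d → Dec (vars d ⊆ varsL Γ)
over? Γ d = vars d ⊆? varsL Γ

relevant : List Formula → List Formula → List Formula
relevant Γ = filter (over? Γ)

relevant-vars : ∀ Γ Δ → varsL (relevant Γ Δ) ⊆ varsL Γ
relevant-vars Γ Δ = varsL-⊆ (proj₂ ∘ ∈-filter⁻ (over? Γ) {xs = Δ})

-- A B₃-valid sequent is classically valid after discarding the succedent
-- formulas with variables outside the antecedent: a classical valuation s
-- is turned into the B₃ valuation restricting s to var(Γ).
b3⇒classical : ∀ {Γ Δ} → ⊨B3 Γ ⇒ Δ → ⊨₂ Γ ⇒ relevant Γ Δ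
b3⇒classical {Γ} {Δ} b3 s sΓ with find (b3 (restrict (varsL Γ) s) vΓ)
  where
  vΓ : All (λ g → eval (restrict (varsL Γ) s) g ≡ one) Γ
  vΓ = All.tabulate (λ {g} g∈Γ →
         trans (restrict-classical s g (vars-∈ g∈Γ)) (T⇒one (All.lookup sΓ g∈Γ)))
... | d , d∈Δ , d≡one = lose (∈-filter⁺ (over? Γ) d∈Δ d⊆Γ)
                             (one⇒T (trans (sym (restrict-classical s d d⊆Γ)) d≡one))
  where d⊆Γ = designated-vars s d d≡one

b3-cutFree-complete : ∀ {Γ Δ} → ⊨B3 Γ ⇒ Δ → B⊢cf Γ ⇒ Δ
b3-cutFree-complete {Γ} {Δ} b3 =
  weaken (classical-complete (b3⇒classical b3) (relevant-vars Γ Δ))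
         ⊆-refl (filter-⊆ (over? Γ) Δ)

-- A B₃
-- consequence Γ ⊨ a is the valid sequent Γ ⇒ a.
mainTheorem5 : (∀ (Γ Δ : List Formula) → NonEmpty (Γ ++ Δ) → ⊨B3 Γ ⇒ Δ → B⊢cf Γ ⇒ Δ)
    × (∀ (Γ : List Formula) (a : Formula) → Γ ⊨B3 a → B⊢ Γ ⇒ (a ∷ []))
mainTheorem5 =
  (λ Γ Δ _ → b3-cutFree-complete) ,
  (λ Γ a Γ⊨a → embed (b3-cutFree-complete (λ v vΓ → here (Γ⊨a v vΓ))))
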